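{- Let $\mathbb{I}$ be an interval satisfying the $n$-dimensional Phoa principle for all $n\le2$. Then $\mathbb{I}$ is Rezk complete, i.e. the map $\mathbb{I}\to\mathbb{I}^{\mathbb{E}}$ given by precomposition with $\mathbb{E}\to\mathbf 1$ is an equivalence.
   Context: Homotopy type theory. An interval is a set $\mathbb{I}$ with bounded meet-semilattice structure $(0,1,\sqcap)$, $i\sqsubseteq j$ meaning $i\sqcap j=i$. $\Delta^n:\equiv\{(i_1,\dots,i_n)\mid i_1\sqsupseteq\dots\sqsupseteq i_n\}$ ($\Delta^0=\mathbf1$, $\Delta^1=\mathbb{I}$, $\Delta^2=\{(j\sqsupseteq i)\}$). $n$-dimensional Phoa principle: every function $\alpha\colon\Delta^n\to\mathbb{I}$ is monotone (componentwise order), and any two functions $\Delta^n\to\mathbb{I}$ agreeing on the vertices $(1^k,0^{n-k})$, $0\le k\le n$, are equal. The walking equivalence $\mathbb{E}$ is the colimit of the zigzag $\Delta^0\leftarrow\Delta^1\to\Delta^2\leftarrow\Delta^1\to\Delta^2\leftarrow\Delta^1\to\Delta^0$, where the outer maps $\Delta^1\to\Delta^0$ are terminal, the maps from the outer copies of $\Delta^1$ into $\Delta^2$ are $i\mapsto(i\sqsupseteq i)$, and the middle $\Delta^1$ maps to the first $\Delta^2$ by $i\mapsto(i\sqsupseteq 0)$ and to the second by $i\mapsto(1\sqsupseteq i)$. -}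

module Defs where

open import Level using (Level; _⊔_) renaming (suc to lsuc)
open import Data.Unit using (⊤; tt)
open import Data.Product using (Σ; Σ-syntax; _×_; _,_; proj₁; proj₂)
open import Data.Nat using (ℕ; zero; suc; _≤_)
open import Data.Vec using (Vec; []; _∷_)
open import Data.Vec.Relation.Binary.Pointwise.Inductive using (Pointwise)
open import Relation.Binary.PropositionalEquality using (_≡_; refl)

record Interval (ℓ : Level) : Set (lsuc ℓ) where
  infixl 7 _⊓_
  infix 4 _⊑_
  field
    Carrier   : Set ℓ
    isSet     : ∀ {x y : Carrier} (p q : x ≡ y) → p ≡ q
    𝟘 𝟙       : Carrier
    _⊓_       : Carrier → Carrier → Carrier
    ⊓-assoc   : ∀ x y z → (x ⊓ y) ⊓ z ≡ x ⊓ (y ⊓ z)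
    ⊓-comm    : ∀ x y → x ⊓ y ≡ y ⊓ x
    ⊓-idem    : ∀ x → x ⊓ x ≡ x
    ⊓-identityʳ : ∀ x → x ⊓ 𝟙 ≡ x
    ⊓-zeroʳ   : ∀ x → x ⊓ 𝟘 ≡ 𝟘

  _⊑_ : Carrier → Carrier → Set ℓ
  i ⊑ j = i ⊓ j ≡ i

module _ {ℓ} (𝕀 : Interval ℓ) where
  open Interval 𝕀 renaming (Carrier to I)

  Chain : ∀ {n} → Vec I n → Set ℓ
  Chain []              = Lift⊤
    where Lift⊤ = Level.Lift ℓ ⊤
  Chain (x ∷ [])        = Level.Lift ℓ ⊤
  Chain (x ∷ y ∷ xs)    = y ⊑ x × Chain (y ∷ xs)

  Δ : ℕ → Set ℓ
  Δ n = Σ (Vec I n) Chain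

  vtx : (n k : ℕ) → Vec I n
  vtx zero    _       = []
  vtx (suc n) zero    = 𝟘 ∷ vtx n zero
  vtx (suc n) (suc k) = 𝟙 ∷ vtx n k

  IsVertex : ∀ n → Δ n → Set ℓ
  IsVertex n x = Σ[ k ∈ ℕ ] (Level.Lift ℓ (k ≤ n) × proj₁ x ≡ vtx n k)

  _≤Δ_ : ∀ {n} → Δ n → Δ n → Set ℓ
  x ≤Δ y = Pointwise _⊑_ (proj₁ x) (proj₁ y)

  -- n-dimensional Phoa principle.  Equality of functions is read
  -- pointwise (function extensionality holds in HoTT).
  Phoa : ℕ → Set ℓ
  Phoa n =
    (∀ (α : Δ n → I) (x y : Δ n) → x ≤Δ y → α x ⊑ α y)
    × (∀ (α β : Δ n → I) → (∀ v → IsVertex n v → α v ≡ β v)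
                         → ∀ x → α x ≡ β x)

  -- the maps of the zigzag defining the walking equivalence 𝔼
  diag : I → Δ 2
  diag i = (i ∷ i ∷ []) , ⊓-idem i , _

  lower : I → Δ 2
  lower i = (i ∷ 𝟘 ∷ []) , (Relation.Binary.PropositionalEquality.trans (⊓-comm 𝟘 i) (⊓-zeroʳ i)) , _
    where import Relation.Binary.PropositionalEquality

  upper : I → Δ 2
  upper i = (𝟙 ∷ i ∷ []) , ⊓-identityʳ i , _

  pt : Δ 0
  pt = [] , _

  -- Maps 𝔼 → 𝕀, i.e. cocones under the zigzag
  --   Δ⁰ ← Δ¹ → Δ² ← Δ¹ → Δ² ← Δ¹ → Δ⁰   with vertex 𝕀.
  -- (𝕀 is a set, so the homotopies are propositions.)
  record Cocone : Set ℓ where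
    constructor cocone
    field
      p₀ : Δ 0 → I
      f  : Δ 2 → I
      g  : Δ 2 → I
      p₁ : Δ 0 → I
      c₀ : ∀ i → f (diag i)  ≡ p₀ pt
      c₁ : ∀ i → f (lower i) ≡ g (upper i)
      c₂ : ∀ i → g (diag i)  ≡ p₁ pt
  open Cocone public

  -- equality of maps 𝔼 → 𝕀 (pointwise on the function components;
  -- the path components live in propositions)
  _≈E_ : Cocone → Cocone → Set ℓ
  C ≈E D = (∀ x → p₀ C x ≡ p₀ D x) × (∀ x → f C x ≡ f D x)
         × (∀ x → g C x ≡ g D x) × (∀ x → p₁ C x ≡ p₁ D x)

  -- precomposition with 𝔼 → 1 :  𝕀 → 𝕀^𝔼
  const𝔼 : I → Cocone
  const𝔼 x = cocone (λ _ → x) (λ _ → x) (λ _ → x) (λ _ → x)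
                    (λ _ → refl) (λ _ → refl) (λ _ → refl)

  -- being an equivalence (between sets): injective and surjective
  RezkComplete : Set ℓ
  RezkComplete =
    (∀ x y → const𝔼 x ≈E const𝔼 y → x ≡ y)
    × (∀ (C : Cocone) → Σ[ x ∈ I ] (const𝔼 x ≈E C))

{-# OPTIONS --safe #-}
-- A map 𝔼 → 𝕀 consists of two maps f, g : Δ² → 𝕀, each constant on the
-- diagonal, glued along f (i, 0) = g (1, i).  By the 2-dimensional Phoa
-- principle a map Δ² → 𝕀 that is constant on the diagonal is constant:
-- its value at the vertex (1, 0) lies between its values at (0, 0) and
-- (1, 1).  So f is constant, and then g (1, 1) = f (1, 0) forces g to be
-- the same constant.
module Submission where

open import Defs
open import Level using (lift)
open import Data.Nat using (ℕ; _≤_; suc; s≤s; z≤n)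
open import Data.Product using (Σ-syntax; _,_; proj₁)
open import Data.Vec using (Vec; []; _∷_)
open import Data.Vec.Relation.Binary.Pointwise.Inductive using ([]; _∷_)
open import Relation.Nullary using (Irrelevant)
open import Relation.Binary.PropositionalEquality
  using (_≡_; refl; sym; trans; cong; cong₂; subst; module ≡-Reasoning)

module _ {ℓ} (𝕀 : Interval ℓ) where
  open Interval 𝕀 renaming (Carrier to I)

  ⊑-antisym : ∀ {x y} → x ⊑ y → y ⊑ x → x ≡ y
  ⊑-antisym {x} {y} x⊑y y⊑x = trans (sym x⊑y) (trans (⊓-comm x y) y⊑x)

  𝟘⊑𝟙 : 𝟘 ⊑ 𝟙
  𝟘⊑𝟙 = ⊓-identityʳ 𝟘

  Chain-irrelevant : ∀ {n} (v : Vec I n) → Irrelevant (Chain 𝕀 v)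
  Chain-irrelevant []            _       _       = refl
  Chain-irrelevant (_ ∷ [])      _       _       = refl
  Chain-irrelevant (_ ∷ y ∷ xs) (p , c) (q , d) =
    cong₂ _,_ (isSet p q) (Chain-irrelevant (y ∷ xs) c d)

  Δ-≡ : ∀ {n} {x y : Δ 𝕀 n} → proj₁ x ≡ proj₁ y → x ≡ y
  Δ-≡ {x = v , c} {y = .v , d} refl = cong (v ,_) (Chain-irrelevant v c d)

  Δ⁰-unique : (x : Δ 𝕀 0) → x ≡ pt 𝕀
  Δ⁰-unique ([] , _) = refl

  Phoa₂-ext : Phoa 𝕀 2 → (α β : Δ 𝕀 2 → I) →
              α (diag 𝕀 𝟘) ≡ β (diag 𝕀 𝟘) →
              α (lower 𝕀 𝟙) ≡ β (lower 𝕀 𝟙) →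
              α (diag 𝕀 𝟙) ≡ β (diag 𝕀 𝟙) →
              ∀ x → α x ≡ β x
  Phoa₂-ext (_ , determined) α β e₀ e₁ e₂ = determined α β onVertices
    where
    agree : ∀ {u v} → u ≡ v → α u ≡ β u → α v ≡ β v
    agree u≡v = subst (λ w → α w ≡ β w) u≡v

    onVertices : ∀ v → IsVertex 𝕀 2 v → α v ≡ β v
    onVertices _ (0 , _ , refl) = agree (Δ-≡ refl) e₀
    onVertices _ (1 , _ , refl) = agree (Δ-≡ refl) e₁
    onVertices _ (2 , _ , refl) = agree (Δ-≡ refl) e₂
    onVertices _ (suc (suc (suc _)) , lift (s≤s (s≤s ())) , _)

  diagonal-constant⇒constant : Phoa 𝕀 2 → (α : Δ 𝕀 2 → I) {a : I} →
                               (∀ i → α (diag 𝕀 i) ≡ a) → ∀ x → α x ≡ a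
  diagonal-constant⇒constant phoa@(monotone , _) α {a} onDiag =
    Phoa₂-ext phoa α (λ _ → a) (onDiag 𝟘) corner≡a (onDiag 𝟙)
    where
    a⊑corner : a ⊑ α (lower 𝕀 𝟙)
    a⊑corner = subst (_⊑ α (lower 𝕀 𝟙)) (onDiag 𝟘)
      (monotone α (diag 𝕀 𝟘) (lower 𝕀 𝟙) (𝟘⊑𝟙 ∷ ⊓-idem 𝟘 ∷ []))

    corner⊑a : α (lower 𝕀 𝟙) ⊑ a
    corner⊑a = subst (α (lower 𝕀 𝟙) ⊑_) (onDiag 𝟙)
      (monotone α (lower 𝕀 𝟙) (diag 𝕀 𝟙) (⊓-idem 𝟙 ∷ 𝟘⊑𝟙 ∷ []))

    corner≡a : α (lower 𝕀 𝟙) ≡ a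
    corner≡a = ⊑-antisym corner⊑a a⊑corner

  const𝔼-injective : ∀ x y → _≈E_ 𝕀 (const𝔼 𝕀 x) (const𝔼 𝕀 y) → x ≡ y
  const𝔼-injective _ _ (p₀≈ , _) = p₀≈ (pt 𝕀)

  const𝔼-surjective : Phoa 𝕀 2 → ∀ (C : Cocone 𝕀) → Σ[ a ∈ I ] _≈E_ 𝕀 (const𝔼 𝕀 a) C
  const𝔼-surjective phoa C =
    a , (λ x → sym (cong (p₀ C) (Δ⁰-unique x))) , (λ x → sym (f≡a x))
      , (λ x → sym (g≡a x)) , (λ x → sym (trans (cong (p₁ C) (Δ⁰-unique x)) b≡a))
    where
    open ≡-Reasoning
    a = p₀ C (pt 𝕀)

    f≡a : ∀ x → f C x ≡ a
    f≡a = diagonal-constant⇒constant phoa (f C) (c₀ C)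

    b≡a : p₁ C (pt 𝕀) ≡ a
    b≡a = begin
      p₁ C (pt 𝕀)         ≡⟨ sym (c₂ C 𝟙) ⟩
      g C (diag 𝕀 𝟙)      ≡⟨ cong (g C) (Δ-≡ refl) ⟩
      g C (upper 𝕀 𝟙)     ≡⟨ sym (c₁ C 𝟙) ⟩
      f C (lower 𝕀 𝟙)     ≡⟨ f≡a (lower 𝕀 𝟙) ⟩
      a                   ∎

    g≡a : ∀ x → g C x ≡ a
    g≡a = diagonal-constant⇒constant phoa (g C) (λ i → trans (c₂ C i) b≡a)

lemmaV9 : ∀ {ℓ} (𝕀 : Interval ℓ) → (∀ (n : ℕ) → n ≤ 2 → Phoa 𝕀 n) → RezkComplete 𝕀
lemmaV9 𝕀 phoa = const𝔼-injective 𝕀 , const𝔼-surjective 𝕀 (phoa 2 (s≤s (s≤s z≤n)))
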